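{- For every $n \ge 6$ there exists $U \subseteq \mathbb{Z}_3^n$ with $|U| = 3^{n-1}+18$ such that the subgraph of $H(n,3)$ induced by $U$ has maximum degree $1$.
   Context: $H(n,3)$ is the Hamming graph: its vertex set is $\mathbb{Z}_3^n$ and two vertices are adjacent if and only if they differ in exactly one coordinate. -}

module Defs where

open import Data.Nat using (ℕ; zero; suc; _+_)
open import Data.Fin using (Fin)
open import Data.Vec using (Vec; []; _∷_)
open import Data.List using (List; length; filter)
open import Relation.Binary.PropositionalEquality using (_≡_)
open import Relation.Nullary using (Dec; yes; no)
open import Data.Fin using (_≟_)

Vertex : ℕ → Set
Vertex n = Vec (Fin 3) n

dist : ∀ {n} → Vertex n → Vertex n → ℕ
dist [] [] = zero
dist (x ∷ xs) (y ∷ ys) with x ≟ y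
... | yes _ = dist xs ys
... | no  _ = suc (dist xs ys)

Adjacent : ∀ {n} → Vertex n → Vertex n → Set
Adjacent u v = dist u v ≡ 1

adjacent? : ∀ {n} (u v : Vertex n) → Dec (Adjacent u v)
adjacent? u v = Data.Nat._≟_ (dist u v) 1

-- Degree of u in the subgraph of H(n,3) induced by the vertex list U
-- (U is assumed duplicate-free where used).
degreeIn : ∀ {n} → List (Vertex n) → Vertex n → ℕ
degreeIn U u = length (filter (adjacent? u) U)

-- Colour the vertices of H(n,3) with four classes U, A, B, X so that every class induces a
-- subgraph of maximum degree at most 1 and all neighbours of X-vertices lie in U. A colouring of
-- H(6,3) with |U| = 3⁵ + 18 and |X| = 18 is verified by computation. It lifts to H(n+1,3) by
-- giving a ∷ x the class shift a (c x), where shift a acts on U, A, B as the a-th power of a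
-- 3-cycle and shift 1, shift 2 send X to U. Two neighbours within a layer share a class after
-- the shift iff they did before, because a shift only merges X with a class other than U; the
-- three copies of a vertex outside X get distinct classes, and those of an X-vertex get X, U, U.
-- Every vertex thus has one copy in U and every X-vertex one more, so |U| becomes 3ⁿ + 18.

module Submission where

open import Defs
open import Data.Nat using (ℕ; zero; suc; _+_; _*_; _^_; _∸_; _≤_; _≥_; _≤′_; ≤′-refl; ≤′-step)
import Data.Nat as ℕ
open import Data.Nat.ListAction using (sum)
open import Data.Nat.Properties using (+-identityʳ; +-suc; ≤⇒≤′; module ≤-Reasoning)
open import Data.Bool using (true; false)
open import Data.Fin as Fin using (Fin; _≟_; funToFin)
open import Data.Fin.Properties using () renaming (all? to ∀-Fin?)
open import Data.Fin.Patterns using (0F; 1F; 2F; 3F)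
open import Data.List using (List; []; _∷_; [_]; _++_; map; filter; length; concatMap; cartesianProductWith; allFin)
open import Data.List.Properties using (filter-++; filter-none; length-++; length-map; ++-identityʳ)
open import Data.List.Membership.Propositional using (_∈_)
open import Data.List.Membership.DecPropositional (_≟_ {3}) using (_∈?_)
open import Data.List.Membership.Propositional.Properties
  using (∈-filter⁺; ∈-filter⁻; ∈-allFin; ∈-cartesianProductWith⁺; ∈-map⁺; ∈-map⁻; ∈-++⁺ˡ; ∈-++⁺ʳ; ∈-++⁻)
open import Data.List.Relation.Unary.All as All using (All; []; _∷_; all?)
import Data.List.Relation.Unary.All.Properties as All
open import Data.List.Relation.Unary.Any using (here)
open import Data.List.Relation.Unary.AllPairs using ([]; _∷_)
open import Data.List.Relation.Unary.Unique.Propositional using (Unique)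
open import Data.List.Relation.Unary.Unique.Propositional.Properties using (cartesianProductWith⁺; allFin⁺; filter⁺)
open import Data.List.Relation.Binary.Permutation.Propositional using (_↭_; ↭-refl; ↭-reflexive; ↭-sym; ↭-trans)
import Data.List.Relation.Binary.Permutation.Propositional.Properties as ↭
open import Data.Product using (Σ; _,_; _×_; ∃-syntax; proj₂)
open import Data.Sum using (inj₁; inj₂)
open import Data.Vec as Vec using (Vec; _∷_; [])
open import Data.Vec.Properties using (∷-injective)
open import Function using (_∘_; _⇔_; Equivalence; mk⇔)
open import Relation.Nullary using (yes; no; does; ¬_)
open import Relation.Nullary.Negation using (contradiction)
open import Relation.Nullary.Decidable using (from-yes; _→-dec_; ¬?)
open import Relation.Unary using (Decidable)
open import Relation.Binary.PropositionalEquality using (_≡_; _≢_; refl; sym; trans; cong; cong₂; module ≡-Reasoning)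

-- Counting in lists

module _ {S T : Set} (f : S → T) {P : T → Set} (P? : Decidable P) where

  filter-map : (xs : List S) → filter P? (map f xs) ≡ map f (filter (P? ∘ f) xs)
  filter-map [] = refl
  filter-map (x ∷ xs) with does (P? (f x))
  ... | true  = cong (f x ∷_) (filter-map xs)
  ... | false = filter-map xs

module _ {T : Set} {P Q : T → Set} (P? : Decidable P) (Q? : Decidable Q) where

  filter-comm : (xs : List T) → filter P? (filter Q? xs) ≡ filter Q? (filter P? xs)
  filter-comm [] = refl
  filter-comm (x ∷ xs) with does (P? x) in p | does (Q? x) in q
  ... | true  | true  rewrite p | q = cong (x ∷_) (filter-comm xs)
  ... | true  | false rewrite q = filter-comm xs
  ... | false | true  rewrite p = filter-comm xs
  ... | false | false = filter-comm xs

filter-reject : {T : Set} {P : T → Set} (P? : Decidable P) → (∀ x → ¬ P x) → (xs : List T) → filter P? xs ≡ []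
filter-reject P? ¬P xs = filter-none P? (All.universal ¬P xs)

module _ {R S T : Set} (f : R → S → T) where

  filter-cartesianProductWith : {P : T → Set} (P? : Decidable P) (xs : List R) (ys : List S) →
    filter P? (cartesianProductWith f xs ys) ≡ concatMap (λ a → map (f a) (filter (P? ∘ f a) ys)) xs
  filter-cartesianProductWith P? [] ys = refl
  filter-cartesianProductWith P? (x ∷ xs) ys =
    trans (filter-++ P? (map (f x) ys) _) (cong₂ _++_ (filter-map (f x) P? ys) (filter-cartesianProductWith P? xs ys))

  length-cartesianProductWith : (xs : List R) (ys : List S) →
    length (cartesianProductWith f xs ys) ≡ length xs * length ys
  length-cartesianProductWith [] ys = refl
  length-cartesianProductWith (x ∷ xs) ys =
    trans (length-++ (map (f x) ys)) (cong₂ _+_ (length-map (f x) ys) (length-cartesianProductWith xs ys))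

count : {T : Set} {P : T → Set} → Decidable P → List T → ℕ
count P? xs = length (filter P? xs)

module _ {T : Set} {P : T → Set} (P? : Decidable P) where

  count-++ : (xs ys : List T) → count P? (xs ++ ys) ≡ count P? xs + count P? ys
  count-++ xs ys = trans (cong length (filter-++ P? xs ys)) (length-++ (filter P? xs))

  count-map : {S : Set} (f : S → T) (xs : List S) → count P? (map f xs) ≡ count (P? ∘ f) xs
  count-map f xs = trans (cong length (filter-map f P? xs)) (length-map f (filter (P? ∘ f) xs))

  count-cartesianProductWith : {R S : Set} (f : R → S → T) (xs : List R) (ys : List S) →
    count P? (cartesianProductWith f xs ys) ≡ sum (map (λ a → count (P? ∘ f a) ys) xs)
  count-cartesianProductWith f [] ys = refl
  count-cartesianProductWith f (x ∷ xs) ys =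
    trans (count-++ (map (f x) ys) _) (cong₂ _+_ (count-map (f x) ys) (count-cartesianProductWith f xs ys))

  count-none : {xs : List T} → All (λ x → ¬ P x) xs → count P? xs ≡ 0
  count-none ¬Ps = cong length (filter-none P? ¬Ps)

  count-cong : {Q : T → Set} (Q? : Decidable Q) {xs : List T} →
    All (λ x → P x ⇔ Q x) xs → count P? xs ≡ count Q? xs
  count-cong Q? [] = refl
  count-cong Q? {x ∷ xs} (P⇔Q ∷ P⇔Qs) with P? x | Q? x
  ... | yes _  | yes _  = cong suc (count-cong Q? P⇔Qs)
  ... | no  _  | no  _  = count-cong Q? P⇔Qs
  ... | yes px | no ¬qx = contradiction (Equivalence.to P⇔Q px) ¬qx
  ... | no ¬px | yes qx = contradiction (Equivalence.from P⇔Q qx) ¬px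

-- The Hamming graph H(n,3)

vertices : (n : ℕ) → List (Vertex n)
vertices zero = [ [] ]
vertices (suc n) = cartesianProductWith _∷_ (allFin 3) (vertices n)

∈-vertices : ∀ {n} (x : Vertex n) → x ∈ vertices n
∈-vertices [] = here refl
∈-vertices (a ∷ x) = ∈-cartesianProductWith⁺ _∷_ (∈-allFin a) (∈-vertices x)

all-vertices⇒∀ : ∀ {n} {P : Vertex n → Set} → All P (vertices n) → ∀ x → P x
all-vertices⇒∀ Ps x = All.lookup Ps (∈-vertices x)

unique-vertices : (n : ℕ) → Unique (vertices n)
unique-vertices zero = [] ∷ []
unique-vertices (suc n) = cartesianProductWith⁺ _∷_ ∷-injective (allFin⁺ 3) (unique-vertices n)

length-vertices : (n : ℕ) → length (vertices n) ≡ 3 ^ n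
length-vertices zero = refl
length-vertices (suc n) =
  trans (length-cartesianProductWith _∷_ (allFin 3) (vertices n)) (cong (3 *_) (length-vertices n))

-- Stated with 1 + dist because that is what adjacent? (a ∷ x) (b ∷ v) reduces to when a ≢ b.
vertices-at-distance-0 : ∀ {n} (x : Vertex n) → filter (λ v → suc (dist x v) ℕ.≟ 1) (vertices n) ≡ [ x ]
vertices-at-distance-0 [] = refl
vertices-at-distance-0 {suc n} (a ∷ x)
  rewrite filter-cartesianProductWith _∷_ (λ v → suc (dist (a ∷ x) v) ℕ.≟ 1) (allFin 3) (vertices n)
  with a
... | 0F rewrite vertices-at-distance-0 x
           | filter-reject (λ v → suc (suc (dist x v)) ℕ.≟ 1) (λ _ ()) (vertices n) = refl
... | 1F rewrite vertices-at-distance-0 x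
           | filter-reject (λ v → suc (suc (dist x v)) ℕ.≟ 1) (λ _ ()) (vertices n) = refl
... | 2F rewrite vertices-at-distance-0 x
           | filter-reject (λ v → suc (suc (dist x v)) ℕ.≟ 1) (λ _ ()) (vertices n) = refl

others : Fin 3 → List (Fin 3)
others 0F = 1F ∷ 2F ∷ []
others 1F = 0F ∷ 2F ∷ []
others 2F = 0F ∷ 1F ∷ []

others-sym : ∀ a b → b ∈ others a → a ∈ others b
others-sym = from-yes (∀-Fin? λ a → ∀-Fin? λ b → (b ∈? others a) →-dec (a ∈? others b))

neighbours : ∀ {n} → Vertex n → List (Vertex n)
neighbours [] = []
neighbours (a ∷ x) = map (a ∷_) (neighbours x) ++ map (_∷ x) (others a)

neighbours-sym : ∀ {n} {x y : Vertex n} → y ∈ neighbours x → x ∈ neighbours y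
neighbours-sym {x = a ∷ x} y∈N with ∈-++⁻ (map (a ∷_) (neighbours x)) y∈N
... | inj₁ y∈layer with ∈-map⁻ (a ∷_) y∈layer
...   | y , y∈Nx , refl = ∈-++⁺ˡ (∈-map⁺ (a ∷_) (neighbours-sym y∈Nx))
neighbours-sym {x = a ∷ x} y∈N | inj₂ y∈column with ∈-map⁻ (_∷ x) y∈column
...   | b , b∈others , refl = ∈-++⁺ʳ (map (b ∷_) (neighbours x)) (∈-map⁺ (_∷ x) (others-sym a b b∈others))

adjacent-vertices↭neighbours : ∀ {n} (x : Vertex n) → filter (adjacent? x) (vertices n) ↭ neighbours x
adjacent-vertices↭neighbours [] = ↭-refl
adjacent-vertices↭neighbours {suc n} (a ∷ x)
  rewrite filter-cartesianProductWith _∷_ (adjacent? (a ∷ x)) (allFin 3) (vertices n)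
  with a
... | 0F rewrite vertices-at-distance-0 x = ↭.++⁺ʳ _ (↭.map⁺ (0F ∷_) (adjacent-vertices↭neighbours x))
... | 1F rewrite vertices-at-distance-0 x =
  ↭-trans (↭.++⁺ˡ [ 0F ∷ x ] (↭.++⁺ʳ _ (↭.map⁺ (1F ∷_) (adjacent-vertices↭neighbours x))))
          (↭-sym (↭.shift (0F ∷ x) (map (1F ∷_) (neighbours x)) _))
... | 2F rewrite vertices-at-distance-0 x =
  ↭-trans (↭.++⁺ˡ column (↭-trans (↭-reflexive (++-identityʳ _))
                                   (↭.map⁺ (2F ∷_) (adjacent-vertices↭neighbours x))))
          (↭.++-comm column (map (2F ∷_) (neighbours x)))
  where column = (0F ∷ x) ∷ (1F ∷ x) ∷ []

count-neighbours-∷ : ∀ {n} {P : Vertex (suc n) → Set} (P? : Decidable P) a (x : Vertex n) →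
  count P? (neighbours (a ∷ x)) ≡ count (P? ∘ (a ∷_)) (neighbours x) + count (P? ∘ (_∷ x)) (others a)
count-neighbours-∷ P? a x =
  trans (count-++ P? (map (a ∷_) (neighbours x)) _)
        (cong₂ _+_ (count-map P? (a ∷_) (neighbours x)) (count-map P? (_∷ x) (others a)))

degreeIn-filter : ∀ {n} {P : Vertex n → Set} (P? : Decidable P) (u : Vertex n) →
  degreeIn (filter P? (vertices n)) u ≡ count P? (neighbours u)
degreeIn-filter {n} P? u = begin
  length (filter (adjacent? u) (filter P? (vertices n)))
    ≡⟨ cong length (filter-comm (adjacent? u) P? (vertices n)) ⟩
  length (filter P? (filter (adjacent? u) (vertices n)))
    ≡⟨ ↭.↭-length (↭.filter-↭ P? (adjacent-vertices↭neighbours u)) ⟩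
  count P? (neighbours u) ∎
  where open ≡-Reasoning

-- Colourings by four classes and their lifts

-- Using Fin 4 gives decidable equality and exhaustive checks over the classes for free.
Class : Set
Class = Fin 4

pattern U = 0F
pattern A = 1F
pattern B = 2F
pattern X = 3F

shift : Fin 3 → Class → Class
shift 0F k = k
shift 1F U = B
shift 1F A = U
shift 1F B = A
shift 1F X = U
shift 2F U = A
shift 2F A = B
shift 2F B = U
shift 2F X = U

lift : ∀ {n} → (Vertex n → Class) → Vertex (suc n) → Class
lift c (a ∷ x) = shift a (c x)

degree : ∀ {n} → (Vertex n → Class) → Class → Vertex n → ℕ
degree c k x = count (λ y → c y ≟ k) (neighbours x)

siblings : Fin 3 → Class → ℕ
siblings a k = count (λ b → shift b k ≟ shift a k) (others a)

shift-injective : ∀ a j k → (j ≡ X → k ≡ U) → (k ≡ X → j ≡ U) → shift a j ≡ shift a k → j ≡ k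
shift-injective = from-yes (∀-Fin? λ a → ∀-Fin? λ j → ∀-Fin? λ k →
  ((j ≟ X) →-dec (k ≟ U)) →-dec (((k ≟ X) →-dec (j ≟ U)) →-dec ((shift a j ≟ shift a k) →-dec (j ≟ k))))

shift-suc≢X : ∀ a k → shift (Fin.suc a) k ≢ X
shift-suc≢X = from-yes (∀-Fin? λ a → ∀-Fin? λ k → ¬? (shift (Fin.suc a) k ≟ X))

siblings≤1 : ∀ a k → siblings a k ≤ 1
siblings≤1 = from-yes (∀-Fin? λ a → ∀-Fin? λ k → siblings a k ℕ.≤? 1)

non-X-siblings≡0 : ∀ a k → k ≢ X → siblings a k ≡ 0
non-X-siblings≡0 = from-yes (∀-Fin? λ a → ∀-Fin? λ k → ¬? (k ≟ X) →-dec (siblings a k ℕ.≟ 0))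

record Admissible {n} (c : Vertex n → Class) : Set where
  field
    degree≤1 : ∀ x → degree c (c x) x ≤ 1
    X-neighbours : ∀ x → c x ≡ X → All (λ y → c y ≡ U) (neighbours x)

module _ {n} {c : Vertex n → Class} (admissible : Admissible c) where
  open Admissible admissible

  X-degree≡0 : ∀ {x} → c x ≡ X → degree c (c x) x ≡ 0
  X-degree≡0 {x} cx≡X =
    trans (cong (λ k → degree c k x) cx≡X) (count-none (λ y → c y ≟ X) (All.map U⇒¬X (X-neighbours x cx≡X)))
    where
    U⇒¬X : ∀ {y} → c y ≡ U → c y ≢ X
    U⇒¬X cy≡U cy≡X with () ← trans (sym cy≡U) cy≡X

  degree-lift : ∀ a x → degree (lift c) (shift a (c x)) (a ∷ x) ≡ degree c (c x) x + siblings a (c x)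
  degree-lift a x = begin
    degree (lift c) (shift a (c x)) (a ∷ x)
      ≡⟨ count-neighbours-∷ (λ y → lift c y ≟ shift a (c x)) a x ⟩
    count (λ y → shift a (c y) ≟ shift a (c x)) (neighbours x) + siblings a (c x)
      ≡⟨ cong (_+ siblings a (c x)) (count-cong _ (λ y → c y ≟ c x) (All.tabulate same-class⇔)) ⟩
    degree c (c x) x + siblings a (c x) ∎
    where
    open ≡-Reasoning
    same-class⇔ : ∀ {y} → y ∈ neighbours x → (shift a (c y) ≡ shift a (c x)) ⇔ (c y ≡ c x)
    same-class⇔ {y} y∈N = mk⇔
      (shift-injective a (c y) (c x) (λ cy≡X → All.lookup (X-neighbours y cy≡X) (neighbours-sym y∈N))
                                     (λ cx≡X → All.lookup (X-neighbours x cx≡X) y∈N))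
      (cong (shift a))

  degree-lift-0F : ∀ {x k} → c x ≡ k → k ≢ X → degree (lift c) k (0F ∷ x) ≡ degree c k x
  degree-lift-0F {x} refl k≢X =
    trans (degree-lift 0F x) (trans (cong (degree c (c x) x +_) (non-X-siblings≡0 0F (c x) k≢X)) (+-identityʳ _))

  lift-admissible : Admissible (lift c)
  lift-admissible = record { degree≤1 = degree≤1′ ; X-neighbours = X-neighbours′ }
    where
    degree≤1′ : ∀ x → degree (lift c) (lift c x) x ≤ 1
    degree≤1′ (a ∷ x) rewrite degree-lift a x with c x ≟ X
    ... | yes cx≡X = begin
      degree c (c x) x + siblings a (c x)  ≡⟨ cong (_+ siblings a (c x)) (X-degree≡0 cx≡X) ⟩
      siblings a (c x)                     ≤⟨ siblings≤1 a (c x) ⟩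
      1                                    ∎
      where open ≤-Reasoning
    ... | no cx≢X = begin
      degree c (c x) x + siblings a (c x)  ≡⟨ cong (degree c (c x) x +_) (non-X-siblings≡0 a (c x) cx≢X) ⟩
      degree c (c x) x + 0                 ≡⟨ +-identityʳ _ ⟩
      degree c (c x) x                     ≤⟨ degree≤1 x ⟩
      1                                    ∎
      where open ≤-Reasoning

    X-neighbours′ : ∀ x → lift c x ≡ X → All (λ y → lift c y ≡ U) (neighbours x)
    X-neighbours′ (0F ∷ x) cx≡X =
      All.++⁺ (All.map⁺ (X-neighbours x cx≡X)) (cong (shift 1F) cx≡X ∷ cong (shift 2F) cx≡X ∷ [])
    X-neighbours′ (Fin.suc a ∷ x) ≡X = contradiction ≡X (shift-suc≢X a (c x))

module _ {T : Set} (c : T → Class) where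

  private
    shifted-to-U : Fin 3 → List T → ℕ
    shifted-to-U a = count (λ y → shift a (c y) ≟ U)

  count-shifts-to-U : (xs : List T) →
    sum (map (λ a → shifted-to-U a xs) (allFin 3)) ≡ length xs + count (λ y → c y ≟ X) xs
  count-shifts-to-U [] = refl
  count-shifts-to-U (y ∷ ys) with c y | count-shifts-to-U ys
  ... | U | ih = cong suc ih
  ... | A | ih = trans (+-suc s₀ _) (cong suc ih)
    where
    s₀ = shifted-to-U 0F ys
  ... | B | ih = trans (cong (s₀ +_) (+-suc s₁ _)) (trans (+-suc s₀ _) (cong suc ih))
    where
    s₀ = shifted-to-U 0F ys
    s₁ = shifted-to-U 1F ys
  ... | X | ih = begin
    s₀ + suc (s₁ + suc (s₂ + 0))      ≡⟨ cong (s₀ +_) (cong suc (+-suc s₁ _)) ⟩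
    s₀ + suc (suc (s₁ + (s₂ + 0)))    ≡⟨ +-suc s₀ _ ⟩
    suc (s₀ + suc (s₁ + (s₂ + 0)))    ≡⟨ cong suc (+-suc s₀ _) ⟩
    suc (suc (s₀ + (s₁ + (s₂ + 0))))  ≡⟨ cong (suc ∘ suc) ih ⟩
    suc (suc (length ys + x))         ≡⟨ cong suc (+-suc (length ys) x) ⟨
    suc (length ys + suc x)           ∎
    where
    open ≡-Reasoning
    s₀ = shifted-to-U 0F ys
    s₁ = shifted-to-U 1F ys
    s₂ = shifted-to-U 2F ys
    x = count (λ y → c y ≟ X) ys

module _ {n} (c : Vertex n → Class) where
  open ≡-Reasoning

  count-lift-U : count (λ v → lift c v ≟ U) (vertices (suc n)) ≡ 3 ^ n + count (λ y → c y ≟ X) (vertices n)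
  count-lift-U = begin
    count (λ v → lift c v ≟ U) (vertices (suc n))
      ≡⟨ count-cartesianProductWith (λ v → lift c v ≟ U) _∷_ (allFin 3) (vertices n) ⟩
    sum (map (λ a → count (λ y → shift a (c y) ≟ U) (vertices n)) (allFin 3))
      ≡⟨ count-shifts-to-U c (vertices n) ⟩
    length (vertices n) + count (λ y → c y ≟ X) (vertices n)
      ≡⟨ cong (_+ count (λ y → c y ≟ X) (vertices n)) (length-vertices n) ⟩
    3 ^ n + count (λ y → c y ≟ X) (vertices n) ∎

  count-lift-X : count (λ v → lift c v ≟ X) (vertices (suc n)) ≡ count (λ y → c y ≟ X) (vertices n)
  count-lift-X = begin
    count (λ v → lift c v ≟ X) (vertices (suc n))
      ≡⟨ count-cartesianProductWith (λ v → lift c v ≟ X) _∷_ (allFin 3) (vertices n) ⟩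
    count (λ y → c y ≟ X) (vertices n) + (shifted-to-X 0F + (shifted-to-X 1F + 0))
      ≡⟨ cong₂ (λ p q → count (λ y → c y ≟ X) (vertices n) + (p + (q + 0))) (none 0F) (none 1F) ⟩
    count (λ y → c y ≟ X) (vertices n) + 0
      ≡⟨ +-identityʳ _ ⟩
    count (λ y → c y ≟ X) (vertices n) ∎
    where
    shifted-to-X : Fin 2 → ℕ
    shifted-to-X a = count (λ y → shift (Fin.suc a) (c y) ≟ X) (vertices n)
    none : ∀ a → shifted-to-X a ≡ 0
    none a = count-none _ (All.universal (λ y → shift-suc≢X a (c y)) (vertices n))

record Construction (n : ℕ) : Set where
  field
    colour : Vertex n → Class
    admissible : Admissible colour
    count-X : count (λ x → colour x ≟ X) (vertices n) ≡ 18
    count-U : count (λ x → colour x ≟ U) (vertices n) ≡ 3 ^ (n ∸ 1) + 18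
    U-vertex-of-degree-1 : ∃[ w ] colour w ≡ U × degree colour U w ≡ 1

lift-construction : ∀ {n} → Construction n → Construction (suc n)
lift-construction {n} C = record
  { colour = lift colour
  ; admissible = lift-admissible admissible
  ; count-X = trans (count-lift-X colour) count-X
  ; count-U = trans (count-lift-U colour) (cong (3 ^ n +_) count-X)
  ; U-vertex-of-degree-1 =
      let w , cw , dw = U-vertex-of-degree-1 in 0F ∷ w , cw , trans (degree-lift-0F admissible cw λ ()) dw
  }
  where open Construction C

-- The classes of the vertices of H(6,3) in lexicographic order; funToFin computes that index.
base-table : Vec Class 729
base-table =
  B ∷ B ∷ U ∷ A ∷ A ∷ U ∷ U ∷ U ∷ X ∷ U ∷ A ∷ B ∷ B ∷ U ∷ A ∷ A ∷ B ∷ U ∷ A ∷ U ∷ B ∷ U ∷ B ∷ A ∷ B ∷ A ∷ U ∷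
  A ∷ U ∷ B ∷ U ∷ B ∷ A ∷ B ∷ A ∷ U ∷ A ∷ B ∷ U ∷ U ∷ A ∷ B ∷ B ∷ U ∷ A ∷ U ∷ A ∷ A ∷ X ∷ U ∷ U ∷ U ∷ B ∷ B ∷
  U ∷ A ∷ B ∷ B ∷ U ∷ A ∷ A ∷ B ∷ U ∷ B ∷ U ∷ A ∷ A ∷ B ∷ U ∷ U ∷ A ∷ B ∷ A ∷ B ∷ U ∷ U ∷ A ∷ B ∷ B ∷ U ∷ A ∷
  A ∷ U ∷ B ∷ U ∷ B ∷ A ∷ B ∷ A ∷ U ∷ B ∷ U ∷ A ∷ A ∷ B ∷ U ∷ U ∷ A ∷ B ∷ U ∷ X ∷ U ∷ B ∷ U ∷ B ∷ A ∷ U ∷ A ∷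
  U ∷ B ∷ A ∷ B ∷ A ∷ U ∷ A ∷ U ∷ B ∷ B ∷ A ∷ U ∷ A ∷ U ∷ B ∷ U ∷ B ∷ A ∷ A ∷ U ∷ B ∷ U ∷ B ∷ A ∷ B ∷ A ∷ U ∷
  B ∷ A ∷ U ∷ A ∷ U ∷ B ∷ U ∷ B ∷ A ∷ U ∷ B ∷ B ∷ U ∷ A ∷ A ∷ X ∷ U ∷ U ∷ B ∷ U ∷ A ∷ A ∷ B ∷ U ∷ U ∷ A ∷ B ∷
  U ∷ A ∷ B ∷ B ∷ U ∷ A ∷ A ∷ B ∷ U ∷ A ∷ B ∷ U ∷ U ∷ A ∷ B ∷ B ∷ U ∷ A ∷ B ∷ U ∷ A ∷ A ∷ B ∷ U ∷ U ∷ A ∷ B ∷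
  B ∷ A ∷ U ∷ A ∷ U ∷ B ∷ U ∷ B ∷ A ∷ U ∷ U ∷ X ∷ B ∷ B ∷ U ∷ A ∷ A ∷ U ∷ A ∷ B ∷ U ∷ U ∷ A ∷ B ∷ B ∷ U ∷ A ∷
  A ∷ U ∷ A ∷ U ∷ X ∷ U ∷ B ∷ U ∷ B ∷ B ∷ A ∷ U ∷ A ∷ U ∷ B ∷ U ∷ B ∷ A ∷ U ∷ A ∷ B ∷ B ∷ U ∷ A ∷ A ∷ B ∷ U ∷
  A ∷ U ∷ B ∷ U ∷ B ∷ A ∷ B ∷ A ∷ U ∷ U ∷ B ∷ A ∷ B ∷ A ∷ U ∷ A ∷ U ∷ B ∷ B ∷ A ∷ U ∷ A ∷ U ∷ B ∷ U ∷ B ∷ A ∷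
  U ∷ X ∷ U ∷ B ∷ U ∷ B ∷ A ∷ U ∷ A ∷ B ∷ U ∷ A ∷ A ∷ B ∷ U ∷ U ∷ A ∷ B ∷ A ∷ U ∷ B ∷ U ∷ B ∷ A ∷ B ∷ A ∷ U ∷
  B ∷ U ∷ A ∷ A ∷ B ∷ U ∷ U ∷ A ∷ B ∷ A ∷ A ∷ U ∷ U ∷ U ∷ X ∷ B ∷ B ∷ U ∷ U ∷ B ∷ A ∷ B ∷ A ∷ U ∷ A ∷ U ∷ B ∷
  U ∷ A ∷ A ∷ X ∷ U ∷ U ∷ U ∷ B ∷ B ∷ A ∷ B ∷ U ∷ U ∷ A ∷ B ∷ B ∷ U ∷ A ∷ A ∷ U ∷ B ∷ U ∷ B ∷ A ∷ B ∷ A ∷ U ∷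
  A ∷ U ∷ B ∷ U ∷ B ∷ A ∷ B ∷ A ∷ U ∷ U ∷ A ∷ B ∷ B ∷ U ∷ A ∷ A ∷ B ∷ U ∷ B ∷ B ∷ U ∷ A ∷ A ∷ U ∷ U ∷ U ∷ X ∷
  A ∷ B ∷ U ∷ U ∷ A ∷ B ∷ B ∷ U ∷ A ∷ B ∷ U ∷ A ∷ A ∷ B ∷ U ∷ U ∷ A ∷ B ∷ U ∷ A ∷ B ∷ B ∷ U ∷ A ∷ A ∷ B ∷ U ∷
  A ∷ B ∷ U ∷ U ∷ A ∷ B ∷ B ∷ U ∷ A ∷ B ∷ U ∷ B ∷ A ∷ U ∷ A ∷ U ∷ X ∷ U ∷ U ∷ B ∷ A ∷ B ∷ A ∷ U ∷ A ∷ U ∷ B ∷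
  B ∷ U ∷ A ∷ A ∷ B ∷ U ∷ U ∷ A ∷ B ∷ A ∷ B ∷ U ∷ U ∷ A ∷ B ∷ B ∷ U ∷ A ∷ U ∷ A ∷ B ∷ B ∷ U ∷ A ∷ A ∷ B ∷ U ∷
  U ∷ A ∷ B ∷ B ∷ U ∷ A ∷ A ∷ B ∷ U ∷ U ∷ B ∷ A ∷ B ∷ A ∷ U ∷ A ∷ U ∷ B ∷ X ∷ U ∷ U ∷ U ∷ B ∷ B ∷ U ∷ A ∷ A ∷
  U ∷ A ∷ B ∷ B ∷ U ∷ A ∷ A ∷ B ∷ U ∷ X ∷ U ∷ U ∷ U ∷ B ∷ B ∷ U ∷ A ∷ A ∷ U ∷ B ∷ A ∷ B ∷ A ∷ U ∷ A ∷ U ∷ B ∷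
  B ∷ U ∷ A ∷ A ∷ B ∷ U ∷ U ∷ A ∷ B ∷ U ∷ A ∷ B ∷ B ∷ U ∷ A ∷ A ∷ B ∷ U ∷ A ∷ B ∷ U ∷ U ∷ A ∷ B ∷ B ∷ U ∷ A ∷
  A ∷ B ∷ U ∷ U ∷ A ∷ B ∷ B ∷ U ∷ A ∷ U ∷ B ∷ A ∷ B ∷ A ∷ U ∷ A ∷ U ∷ B ∷ B ∷ U ∷ B ∷ A ∷ U ∷ A ∷ U ∷ X ∷ U ∷
  A ∷ B ∷ U ∷ U ∷ A ∷ B ∷ B ∷ U ∷ A ∷ U ∷ A ∷ B ∷ B ∷ U ∷ A ∷ A ∷ B ∷ U ∷ B ∷ U ∷ A ∷ A ∷ B ∷ U ∷ U ∷ A ∷ B ∷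
  B ∷ A ∷ U ∷ A ∷ U ∷ B ∷ U ∷ B ∷ A ∷ A ∷ U ∷ A ∷ U ∷ X ∷ U ∷ B ∷ U ∷ B ∷ U ∷ A ∷ B ∷ B ∷ U ∷ A ∷ A ∷ B ∷ U ∷
  U ∷ U ∷ X ∷ B ∷ B ∷ U ∷ A ∷ A ∷ U ∷ B ∷ A ∷ U ∷ A ∷ U ∷ B ∷ U ∷ B ∷ A ∷ A ∷ B ∷ U ∷ U ∷ A ∷ B ∷ B ∷ U ∷ A ∷
  B ∷ U ∷ A ∷ A ∷ B ∷ U ∷ U ∷ A ∷ B ∷ U ∷ B ∷ A ∷ B ∷ A ∷ U ∷ A ∷ U ∷ B ∷ A ∷ A ∷ U ∷ U ∷ U ∷ X ∷ B ∷ B ∷ U ∷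
  U ∷ B ∷ B ∷ U ∷ A ∷ A ∷ X ∷ U ∷ U ∷ B ∷ A ∷ U ∷ A ∷ U ∷ B ∷ U ∷ B ∷ A ∷ B ∷ U ∷ A ∷ A ∷ B ∷ U ∷ U ∷ A ∷ B ∷
  B ∷ A ∷ U ∷ A ∷ U ∷ B ∷ U ∷ B ∷ A ∷ A ∷ U ∷ B ∷ U ∷ B ∷ A ∷ B ∷ A ∷ U ∷ U ∷ B ∷ A ∷ B ∷ A ∷ U ∷ A ∷ U ∷ B ∷ []

base-colour : Vertex 6 → Class
base-colour x = Vec.lookup base-table (funToFin (Vec.lookup x))

base-construction : Construction 6
base-construction = record
  { colour = base-colour
  ; admissible = record
    { degree≤1 = all-vertices⇒∀
        (from-yes (all? (λ x → degree base-colour (base-colour x) x ℕ.≤? 1) (vertices 6)))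
    ; X-neighbours = all-vertices⇒∀
        (from-yes (all? (λ x → (base-colour x ≟ X) →-dec all? (λ y → base-colour y ≟ U) (neighbours x)) (vertices 6)))
    }
  ; count-X = refl
  ; count-U = refl
  ; U-vertex-of-degree-1 = 0F ∷ 0F ∷ 0F ∷ 0F ∷ 0F ∷ 2F ∷ [] , refl , refl
  }

construction : ∀ {n} → 6 ≤′ n → Construction n
construction ≤′-refl = base-construction
construction (≤′-step 6≤′n) = lift-construction (construction 6≤′n)

theorem1p4 : (n : ℕ) → n ≥ 6 →
    Σ (List (Vertex n)) λ U →
      Unique U
      × length U ≡ 3 ^ (n ∸ 1) + 18
      × All (λ u → degreeIn U u ≤ 1) U
      × (∃[ u ] (u ∈ U × degreeIn U u ≡ 1))
theorem1p4 n n≥6 =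
  class-U , filter⁺ in-U? (unique-vertices n) , count-U ,
  All.tabulate degree≤1-in-U , degree-1-witness U-vertex-of-degree-1
  where
  open Construction (construction (≤⇒≤′ n≥6))
  in-U? : Decidable (λ x → colour x ≡ U)
  in-U? x = colour x ≟ U
  class-U : List (Vertex n)
  class-U = filter in-U? (vertices n)
  degree≤1-in-U : ∀ {u} → u ∈ class-U → degreeIn class-U u ≤ 1
  degree≤1-in-U {u} u∈U = begin
    degreeIn class-U u         ≡⟨ degreeIn-filter in-U? u ⟩
    degree colour U u          ≡⟨ cong (λ k → degree colour k u) (proj₂ (∈-filter⁻ in-U? {xs = vertices n} u∈U)) ⟨
    degree colour (colour u) u ≤⟨ Admissible.degree≤1 admissible u ⟩
    1                          ∎
    where open ≤-Reasoning
  degree-1-witness : (∃[ w ] colour w ≡ U × degree colour U w ≡ 1) →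
                     ∃[ u ] (u ∈ class-U × degreeIn class-U u ≡ 1)
  degree-1-witness (w , cw , dw) = w , ∈-filter⁺ in-U? (∈-vertices w) cw , trans (degreeIn-filter in-U? w) dw
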